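{- Let $G$ be a subcubic graph. (i) If $G$ contains an induced copy of $A_1$, then $\alpha(G-V(A_1))=\alpha(G)-3$. (ii) If $G$ contains an induced copy of $A_2$ in which the vertices labelled $3$, $y$, $6$ have degree $2$ in $G$, then $\alpha(G-V(A_2))=\alpha(G)-4$. (iii) If $G$ contains an induced copy of $A_3$, then $\alpha(G-V(A_3))=\alpha(G)-4$.
   Context: Graphs are finite, simple, undirected; subcubic means maximum degree at most $3$; $\alpha$ is the independence number; $G-V(A)$ denotes deletion of the vertices of the copy. The graphs are defined as follows. $A_1$ has vertices $1,2,3,4,5,6,x,y$ and edges forming the cycle $1\,2\,3\,4\,5\,6\,1$ together with $x2,x5,y3,y6,xy$. $A_2$ has vertices $a,1,2,3,4,5,6,x,y$ and edges forming the cycle $a\,1\,6\,5\,4\,3\,2\,x\,y\,a$ together with the chords $12$ and $5x$. $A_3$ is obtained from $A_2$ by adding one more vertex $z$ adjacent to $6$, $y$ and $3$. -}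

module Defs where

open import Data.Nat using (ℕ; _≤_; _+_)
open import Data.Bool using (Bool; true; false; _∧_; _∨_)
open import Data.Fin using (Fin; zero; suc; _≟_; #_)
open import Data.Fin.Subset using (Subset; _∈_; ∣_∣)
open import Data.Vec using (tabulate)
open import Data.List using (List; []; _∷_)
open import Data.Bool.ListAction using (any)
open import Data.Product using (Σ; _×_; _,_)
open import Data.Unit using (⊤)
open import Relation.Binary.PropositionalEquality using (_≡_; _≢_)
open import Relation.Nullary.Decidable using (⌊_⌋)
open import Function.Definitions using (Injective)

record Graph : Set where
  field
    n      : ℕ
    adj    : Fin n → Fin n → Bool
    sym    : ∀ u v → adj u v ≡ adj v u
    irrefl : ∀ v → adj v v ≡ false
open Graph public

deg : (G : Graph) → Fin (n G) → ℕ
deg G v = ∣ tabulate (adj G v) ∣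

Subcubic : Graph → Set
Subcubic G = ∀ v → deg G v ≤ 3

Independent : (G : Graph) → Subset (n G) → Set
Independent G S = ∀ u v → u ∈ S → v ∈ S → adj G u v ≡ false

-- IsAlphaOn G W k : k is the independence number of the induced subgraph
-- G[W] (independent sets of G all of whose vertices lie in W).
IsAlphaOn : (G : Graph) → (Fin (n G) → Set) → ℕ → Set
IsAlphaOn G W k =
  Σ (Subset (n G)) (λ S → Independent G S × (∀ v → v ∈ S → W v) × ∣ S ∣ ≡ k)
  × (∀ S → Independent G S → (∀ v → v ∈ S → W v) → ∣ S ∣ ≤ k)

IsAlpha : Graph → ℕ → Set
IsAlpha G k = IsAlphaOn G (λ _ → ⊤) k

fromEdges : {m : ℕ} → List (Fin m × Fin m) → Fin m → Fin m → Bool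
fromEdges es i j = any (λ { (u , v) → (⌊ i ≟ u ⌋ ∧ ⌊ j ≟ v ⌋) ∨ (⌊ i ≟ v ⌋ ∧ ⌊ j ≟ u ⌋) }) es

-- A1: vertices 1..6 ↦ #0..#5, x ↦ #6, y ↦ #7.
-- cycle 1 2 3 4 5 6 1, plus x2, x5, y3, y6, xy.
A1 : Fin 8 → Fin 8 → Bool
A1 = fromEdges ((# 0 , # 1) ∷ (# 1 , # 2) ∷ (# 2 , # 3) ∷ (# 3 , # 4) ∷ (# 4 , # 5) ∷ (# 5 , # 0)
               ∷ (# 6 , # 1) ∷ (# 6 , # 4) ∷ (# 7 , # 2) ∷ (# 7 , # 5) ∷ (# 6 , # 7) ∷ [])

-- A2: vertices 1..6 ↦ #0..#5, x ↦ #6, y ↦ #7, a ↦ #8.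
-- cycle a 1 6 5 4 3 2 x y a, chords 12 and 5x.
A2edges : List (Fin 10 × Fin 10)
A2edges = (# 8 , # 0) ∷ (# 0 , # 5) ∷ (# 5 , # 4) ∷ (# 4 , # 3) ∷ (# 3 , # 2) ∷ (# 2 , # 1)
        ∷ (# 1 , # 6) ∷ (# 6 , # 7) ∷ (# 7 , # 8) ∷ (# 0 , # 1) ∷ (# 4 , # 6) ∷ []

-- (A2edges is typed over Fin 10 so that it can be reused for A3;
-- A2 itself lives on Fin 9 via the restriction below.)
A2 : Fin 9 → Fin 9 → Bool
A2 i j = fromEdges A2edges (Data.Fin.inject₁ i) (Data.Fin.inject₁ j)

-- A3: A2 plus z ↦ #9 adjacent to 6 (#5), y (#7), 3 (#2).
A3 : Fin 10 → Fin 10 → Bool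
A3 = fromEdges ((# 9 , # 5) ∷ (# 9 , # 7) ∷ (# 9 , # 2) ∷ A2edges)

InducedCopy : (G : Graph) → (k : ℕ) → (Fin k → Fin k → Bool) → Set
InducedCopy G k H =
  Σ (Fin k → Fin (n G)) (λ f → Injective _≡_ _≡_ f × (∀ i j → adj G (f i) (f j) ≡ H i j))

Outside : (G : Graph) {k : ℕ} → (Fin k → Fin (n G)) → Fin (n G) → Set
Outside G f v = ∀ i → f i ≢ v

-- Let f be an induced copy of a pattern H in G with α(H) ≤ r, and let I be an
-- independent set of H of size r none of whose vertices has a G-neighbour outside
-- the copy. An independent set of G meets the copy in an independent set of H, so
-- α(G) ≤ α(G - copy) + r; conversely f(I) can be added to any independent set of
-- G - copy, so α(G) ≥ α(G - copy) + r. A vertex of the copy has no neighbour outside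
-- it as soon as its degree in G is at most its degree in H, which subcubicity or the
-- degree hypotheses of (ii) give for I = {3, 6, x} in A₁ and I = {1, 3, 5, y} in A₂, A₃.
module Submission where

open import Defs hiding (sym)
open import Data.Nat using (ℕ; suc; _+_; _≤_; _≤?_)
open import Data.Nat.Properties
  using (≤-antisym; ≤-reflexive; <-irrefl; +-suc; +-mono-≤; module ≤-Reasoning)
open import Data.Bool using (Bool; true; false)
open import Data.Bool.Properties using () renaming (_≟_ to _≟ᵇ_)
open import Data.Fin using (Fin; zero; suc; #_)
open import Data.Fin.Properties using (all?; suc-injective; 0≢1+n)
open import Data.Fin.Subset
  using (Subset; inside; outside; _∈_; _∉_; _⊆_; ⊥; ⊤; ⁅_⁆; ⋃; _∪_; _∩_; _─_; _-_; ∣_∣; Empty)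
open import Data.Fin.Subset.Properties
  using (_∈?_; ∈⊤; ∉⊥; ∣⊥∣≡0; x∈⁅x⁆; x∈⁅y⁆⇒x≡y; ∣⁅x⁆∣≡1; x∈p∪q⁺; x∈p∪q⁻; x∈p∩q⁻; p─q⊆p;
         x∈p∧x≢y⇒x∈p-y; x∈p⇒∣p-x∣<∣p∣; p⊆q⇒∣p∣≤∣q∣; anySubset?)
open import Data.Vec using ([]; _∷_; lookup; tabulate; here; there)
open import Data.Vec.Properties using ([]=⇒lookup; lookup⇒[]=; lookup∘tabulate)
open import Data.List using (List; []; _∷_; map)
open import Data.List.Relation.Unary.All using (All; []; _∷_) renaming (lookup to All-lookup)
import Data.List.Relation.Unary.Any as Any
open import Data.List.Membership.Propositional using () renaming (_∈_ to _∈ₗ_)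
open import Data.Product as Product using (∃; _×_; _,_; proj₁; proj₂)
open import Data.Sum using (inj₁; inj₂)
open import Data.Unit using (tt)
open import Data.Empty using (⊥-elim)
open import Function using (_∘_)
open import Function.Definitions using (Injective)
open import Relation.Nullary using (Dec; ¬?; contradiction)
open import Relation.Nullary.Decidable using (_→-dec_; from-yes; decidable-stable; map′)
open import Relation.Binary.PropositionalEquality using (_≡_; refl; sym; trans; cong; cong₂; subst)

private
  variable
    k l : ℕ

∈-tabulate⁺ : {b : Fin l → Bool} {x : Fin l} → b x ≡ true → x ∈ tabulate b
∈-tabulate⁺ {b = b} {x} bx≡true = lookup⇒[]= x (tabulate b) (trans (lookup∘tabulate b x) bx≡true)

∈-tabulate⁻ : {b : Fin l → Bool} {x : Fin l} → x ∈ tabulate b → b x ≡ true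
∈-tabulate⁻ {b = b} {x} x∈b = trans (sym (lookup∘tabulate b x)) ([]=⇒lookup x∈b)

x∈p─q⇒x∉q : {x : Fin l} (p q : Subset l) → x ∈ p ─ q → x ∉ q
x∈p─q⇒x∉q (inside ∷ p) (outside ∷ q) here        ()
x∈p─q⇒x∉q (_      ∷ p) (_       ∷ q) (there x∈) (there x∈q) = x∈p─q⇒x∉q p q x∈ x∈q

∣p∣≡∣p─q∣+∣p∩q∣ : (p q : Subset l) → ∣ p ∣ ≡ ∣ p ─ q ∣ + ∣ p ∩ q ∣
∣p∣≡∣p─q∣+∣p∩q∣ []            []            = refl
∣p∣≡∣p─q∣+∣p∩q∣ (inside  ∷ p) (inside  ∷ q) = trans (cong suc (∣p∣≡∣p─q∣+∣p∩q∣ p q)) (sym (+-suc _ _))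
∣p∣≡∣p─q∣+∣p∩q∣ (inside  ∷ p) (outside ∷ q) = cong suc (∣p∣≡∣p─q∣+∣p∩q∣ p q)
∣p∣≡∣p─q∣+∣p∩q∣ (outside ∷ p) (inside  ∷ q) = ∣p∣≡∣p─q∣+∣p∩q∣ p q
∣p∣≡∣p─q∣+∣p∩q∣ (outside ∷ p) (outside ∷ q) = ∣p∣≡∣p─q∣+∣p∩q∣ p q

∣p∪q∣≡∣p∣+∣q∣ : (p q : Subset l) → Empty (p ∩ q) → ∣ p ∪ q ∣ ≡ ∣ p ∣ + ∣ q ∣
∣p∪q∣≡∣p∣+∣q∣ []            []            _     = refl
∣p∪q∣≡∣p∣+∣q∣ (inside  ∷ p) (inside  ∷ q) p∩q=∅ = contradiction (zero , here) p∩q=∅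
∣p∪q∣≡∣p∣+∣q∣ (inside  ∷ p) (outside ∷ q) p∩q=∅ =
  cong suc (∣p∪q∣≡∣p∣+∣q∣ p q (p∩q=∅ ∘ Product.map suc there))
∣p∪q∣≡∣p∣+∣q∣ (outside ∷ p) (inside  ∷ q) p∩q=∅ =
  trans (cong suc (∣p∪q∣≡∣p∣+∣q∣ p q (p∩q=∅ ∘ Product.map suc there))) (sym (+-suc _ _))
∣p∪q∣≡∣p∣+∣q∣ (outside ∷ p) (outside ∷ q) p∩q=∅ =
  ∣p∪q∣≡∣p∣+∣q∣ p q (p∩q=∅ ∘ Product.map suc there)

image : (Fin k → Fin l) → Subset k → Subset l
image f []            = ⊥
image f (inside  ∷ p) = ⁅ f zero ⁆ ∪ image (f ∘ suc) p
image f (outside ∷ p) = image (f ∘ suc) p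

∈-image⁺ : (f : Fin k → Fin l) {p : Subset k} {i : Fin k} → i ∈ p → f i ∈ image f p
∈-image⁺ f {inside  ∷ p} here        = x∈p∪q⁺ (inj₁ (x∈⁅x⁆ (f zero)))
∈-image⁺ f {inside  ∷ p} (there i∈p) = x∈p∪q⁺ (inj₂ (∈-image⁺ (f ∘ suc) i∈p))
∈-image⁺ f {outside ∷ p} (there i∈p) = ∈-image⁺ (f ∘ suc) i∈p

∈-image⁻ : (f : Fin k → Fin l) (p : Subset k) {v : Fin l} → v ∈ image f p → ∃ λ i → i ∈ p × f i ≡ v
∈-image⁻ f []            v∈ = contradiction v∈ ∉⊥
∈-image⁻ f (inside  ∷ p) v∈ with x∈p∪q⁻ ⁅ f zero ⁆ (image (f ∘ suc) p) v∈
... | inj₁ v∈⁅f0⁆ = zero , here , sym (x∈⁅y⁆⇒x≡y (f zero) v∈⁅f0⁆)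
... | inj₂ v∈img  = Product.map suc (Product.map₁ there) (∈-image⁻ (f ∘ suc) p v∈img)
∈-image⁻ f (outside ∷ p) v∈ = Product.map suc (Product.map₁ there) (∈-image⁻ (f ∘ suc) p v∈)

∣image∣≡∣p∣ : (f : Fin k → Fin l) → Injective _≡_ _≡_ f → (p : Subset k) → ∣ image f p ∣ ≡ ∣ p ∣
∣image∣≡∣p∣ {l = l} f f-inj []   = ∣⊥∣≡0 l
∣image∣≡∣p∣ f f-inj (inside  ∷ p) =
  trans (∣p∪q∣≡∣p∣+∣q∣ ⁅ f zero ⁆ (image (f ∘ suc) p) f0∉img)
        (cong₂ _+_ (∣⁅x⁆∣≡1 (f zero)) (∣image∣≡∣p∣ (f ∘ suc) (suc-injective ∘ f-inj) p))
  where
  f0∉img : Empty (⁅ f zero ⁆ ∩ image (f ∘ suc) p)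
  f0∉img (v , v∈) with x∈p∩q⁻ ⁅ f zero ⁆ (image (f ∘ suc) p) v∈
  ... | v∈⁅f0⁆ , v∈img with ∈-image⁻ (f ∘ suc) p v∈img
  ...   | i , _ , fi≡v = 0≢1+n (sym (f-inj (trans fi≡v (x∈⁅y⁆⇒x≡y (f zero) v∈⁅f0⁆))))
∣image∣≡∣p∣ f f-inj (outside ∷ p) = ∣image∣≡∣p∣ (f ∘ suc) (suc-injective ∘ f-inj) p

preimage : (Fin k → Fin l) → Subset l → Subset k
preimage f S = tabulate (lookup S ∘ f)

∈-preimage⁺ : {f : Fin k → Fin l} {S : Subset l} {i : Fin k} → f i ∈ S → i ∈ preimage f S
∈-preimage⁺ fi∈S = ∈-tabulate⁺ ([]=⇒lookup fi∈S)

∈-preimage⁻ : {f : Fin k → Fin l} {S : Subset l} {i : Fin k} → i ∈ preimage f S → f i ∈ S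
∈-preimage⁻ {f = f} {S} {i} i∈ = lookup⇒[]= (f i) S (∈-tabulate⁻ i∈)

fromList : List (Fin l) → Subset l
fromList xs = ⋃ (map ⁅_⁆ xs)

∈-fromList⁻ : {x : Fin l} (xs : List (Fin l)) → x ∈ fromList xs → x ∈ₗ xs
∈-fromList⁻ []       x∈ = contradiction x∈ ∉⊥
∈-fromList⁻ (y ∷ xs) x∈ with x∈p∪q⁻ ⁅ y ⁆ (fromList xs) x∈
... | inj₁ x∈⁅y⁆ = Any.here (x∈⁅y⁆⇒x≡y y x∈⁅y⁆)
... | inj₂ x∈xs  = Any.there (∈-fromList⁻ xs x∈xs)

IndependentIn : (Fin k → Fin k → Bool) → Subset k → Set
IndependentIn H S = ∀ u v → u ∈ S → v ∈ S → H u v ≡ false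

independentIn? : (H : Fin k → Fin k → Bool) (S : Subset k) → Dec (IndependentIn H S)
independentIn? H S = all? λ u → all? λ v → u ∈? S →-dec v ∈? S →-dec H u v ≟ᵇ false

AlphaAtMost : (Fin k → Fin k → Bool) → ℕ → Set
AlphaAtMost H r = ∀ S → IndependentIn H S → ∣ S ∣ ≤ r

allSubsets? : {P : Subset k → Set} → (∀ S → Dec (P S)) → Dec (∀ S → P S)
allSubsets? P? = map′ (λ ∄¬P S → decidable-stable (P? S) (λ ¬PS → ∄¬P (S , ¬PS)))
                      (λ ∀P (S , ¬PS) → ¬PS (∀P S))
                      (¬? (anySubset? (¬? ∘ P?)))

alphaAtMost? : (H : Fin k → Fin k → Bool) (r : ℕ) → Dec (AlphaAtMost H r)
alphaAtMost? H r = allSubsets? λ S → independentIn? H S →-dec ∣ S ∣ ≤? r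

module CopyRemoval (G : Graph) {k : ℕ} {H : Fin k → Fin k → Bool} (copy : InducedCopy G k H) where

  private
    f : Fin k → Fin (n G)
    f = proj₁ copy

    f-injective : Injective _≡_ _≡_ f
    f-injective = proj₁ (proj₂ copy)

    f-induced : ∀ i j → adj G (f i) (f j) ≡ H i j
    f-induced = proj₂ (proj₂ copy)

  OutsideCopy : Subset (n G) → Set
  OutsideCopy T = ∀ v → v ∈ T → Outside G f v

  NoNeighbourOutside : Fin k → Set
  NoNeighbourOutside i = ∀ t → Outside G f t → adj G t (f i) ≡ false

  noNeighbourOutside : ∀ i → deg G (f i) ≤ ∣ tabulate (H i) ∣ → NoNeighbourOutside i
  noNeighbourOutside i deg≤ t t-out with adj G t (f i) in t~fi
  ... | false = refl
  ... | true  = ⊥-elim (<-irrefl refl (begin-strict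
      ∣ Nᴴ ∣                  ≡⟨ sym (∣image∣≡∣p∣ f f-injective Nᴴ) ⟩
      ∣ image f Nᴴ ∣          ≤⟨ p⊆q⇒∣p∣≤∣q∣ image⊆Nᴳ-t ⟩
      ∣ Nᴳ - t ∣              <⟨ x∈p⇒∣p-x∣<∣p∣ t∈Nᴳ ⟩
      ∣ Nᴳ ∣                  ≤⟨ deg≤ ⟩
      ∣ Nᴴ ∣                  ∎))
    where
    open ≤-Reasoning
    Nᴴ = tabulate (H i)
    Nᴳ = tabulate (adj G (f i))
    t∈Nᴳ : t ∈ Nᴳ
    t∈Nᴳ = ∈-tabulate⁺ (trans (Graph.sym G (f i) t) t~fi)
    image⊆Nᴳ-t : image f Nᴴ ⊆ Nᴳ - t
    image⊆Nᴳ-t v∈ with ∈-image⁻ f Nᴴ v∈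
    ... | j , j∈Nᴴ , refl =
      x∈p∧x≢y⇒x∈p-y (∈-tabulate⁺ (trans (f-induced i j) (∈-tabulate⁻ j∈Nᴴ))) (t-out j)

  preimage-independent : ∀ {S} → Independent G S → IndependentIn H (preimage f S)
  preimage-independent indS i j i∈ j∈ =
    trans (sym (f-induced i j)) (indS (f i) (f j) (∈-preimage⁻ i∈) (∈-preimage⁻ j∈))

  independent-size≤ : ∀ {b r} → (∀ T → Independent G T → OutsideCopy T → ∣ T ∣ ≤ b) →
                      AlphaAtMost H r → ∀ S → Independent G S → ∣ S ∣ ≤ b + r
  independent-size≤ {b} {r} α-outside α-H S indS = begin
      ∣ S ∣                    ≡⟨ ∣p∣≡∣p─q∣+∣p∩q∣ S V ⟩
      ∣ S ─ V ∣ + ∣ S ∩ V ∣    ≤⟨ +-mono-≤ outsidePart≤ insidePart≤ ⟩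
      b + r                    ∎
    where
    open ≤-Reasoning
    V = image f ⊤
    outsidePart-independent : Independent G (S ─ V)
    outsidePart-independent u v u∈ v∈ = indS u v (p─q⊆p S V u∈) (p─q⊆p S V v∈)
    outsidePart-outside : OutsideCopy (S ─ V)
    outsidePart-outside v v∈ i refl = x∈p─q⇒x∉q S V v∈ (∈-image⁺ f ∈⊤)
    outsidePart≤ : ∣ S ─ V ∣ ≤ b
    outsidePart≤ = α-outside (S ─ V) outsidePart-independent outsidePart-outside
    insidePart⊆ : S ∩ V ⊆ image f (preimage f S)
    insidePart⊆ v∈ with x∈p∩q⁻ S V v∈
    ... | v∈S , v∈V with ∈-image⁻ f ⊤ v∈V
    ...   | i , _ , refl = ∈-image⁺ f (∈-preimage⁺ v∈S)
    insidePart≤ : ∣ S ∩ V ∣ ≤ r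
    insidePart≤ = begin
      ∣ S ∩ V ∣                    ≤⟨ p⊆q⇒∣p∣≤∣q∣ insidePart⊆ ⟩
      ∣ image f (preimage f S) ∣   ≡⟨ ∣image∣≡∣p∣ f f-injective (preimage f S) ⟩
      ∣ preimage f S ∣             ≤⟨ α-H (preimage f S) (preimage-independent indS) ⟩
      r                            ∎

  module _ {T : Subset (n G)} {I : Subset k} (T-outside : OutsideCopy T) where

    ∣T∪image∣≡∣T∣+∣I∣ : ∣ T ∪ image f I ∣ ≡ ∣ T ∣ + ∣ I ∣
    ∣T∪image∣≡∣T∣+∣I∣ =
      trans (∣p∪q∣≡∣p∣+∣q∣ T (image f I) disjoint) (cong (∣ T ∣ +_) (∣image∣≡∣p∣ f f-injective I))
      where
      disjoint : Empty (T ∩ image f I)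
      disjoint (v , v∈) with x∈p∩q⁻ T (image f I) v∈
      ... | v∈T , v∈img with ∈-image⁻ f I v∈img
      ...   | i , _ , fi≡v = T-outside v v∈T i fi≡v

    T∪image-independent : Independent G T → IndependentIn H I → (∀ {i} → i ∈ I → NoNeighbourOutside i) →
                          Independent G (T ∪ image f I)
    T∪image-independent indT indI I-closed u v u∈ v∈
      with x∈p∪q⁻ T (image f I) u∈ | x∈p∪q⁻ T (image f I) v∈
    ... | inj₁ u∈T | inj₁ v∈T = indT u v u∈T v∈T
    ... | inj₁ u∈T | inj₂ v∈img with ∈-image⁻ f I v∈img
    ...   | j , j∈I , refl = I-closed j∈I u (T-outside u u∈T)
    T∪image-independent indT indI I-closed u v u∈ v∈
        | inj₂ u∈img | inj₁ v∈T with ∈-image⁻ f I u∈img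
    ...   | i , i∈I , refl = trans (Graph.sym G (f i) v) (I-closed i∈I v (T-outside v v∈T))
    T∪image-independent indT indI I-closed u v u∈ v∈
        | inj₂ u∈img | inj₂ v∈img with ∈-image⁻ f I u∈img | ∈-image⁻ f I v∈img
    ...   | i , i∈I , refl | j , j∈I , refl = trans (f-induced i j) (indI i j i∈I j∈I)

  α-drop : ∀ {r} (is : List (Fin k)) → AlphaAtMost H r →
           IndependentIn H (fromList is) → ∣ fromList is ∣ ≡ r → All NoNeighbourOutside is →
           ∀ a b → IsAlpha G a → IsAlphaOn G (Outside G f) b → b + r ≡ a
  α-drop {r} is α-H indI ∣I∣≡r I-closed a b
         ((S , indS , _ , ∣S∣≡a) , α-G) ((T , indT , T-out , ∣T∣≡b) , α-outside) = ≤-antisym lower upper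
    where
    I = fromList is
    lower : b + r ≤ a
    lower = subst (_≤ a) (trans (∣T∪image∣≡∣T∣+∣I∣ {I = I} T-out) (cong₂ _+_ ∣T∣≡b ∣I∣≡r))
                  (α-G _ (T∪image-independent T-out indT indI (All-lookup I-closed ∘ ∈-fromList⁻ is))
                       (λ _ _ → tt))
    upper : a ≤ b + r
    upper = subst (_≤ b + r) ∣S∣≡a (independent-size≤ α-outside α-H S indS)

α[A1]≤3 : AlphaAtMost A1 3
α[A1]≤3 = from-yes (alphaAtMost? A1 3)

α[A2]≤4 : AlphaAtMost A2 4
α[A2]≤4 = from-yes (alphaAtMost? A2 4)

α[A3]≤4 : AlphaAtMost A3 4
α[A3]≤4 = from-yes (alphaAtMost? A3 4)

lemma8 : (G : Graph) → Subcubic G →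
    -- (i)
    ((c : InducedCopy G 8 A1) → ∀ a b → IsAlpha G a → IsAlphaOn G (Outside G (proj₁ c)) b → b + 3 ≡ a)
    -- (ii)  labels 3 ↦ #2, y ↦ #7, 6 ↦ #5
    × ((c : InducedCopy G 9 A2) →
        deg G (proj₁ c (# 2)) ≡ 2 → deg G (proj₁ c (# 7)) ≡ 2 → deg G (proj₁ c (# 5)) ≡ 2 →
        ∀ a b → IsAlpha G a → IsAlphaOn G (Outside G (proj₁ c)) b → b + 4 ≡ a)
    -- (iii)
    × ((c : InducedCopy G 10 A3) → ∀ a b → IsAlpha G a → IsAlphaOn G (Outside G (proj₁ c)) b → b + 4 ≡ a)
lemma8 G subcubic =
    (λ c → let open CopyRemoval G c; is = # 2 ∷ # 5 ∷ # 6 ∷ [] in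
      α-drop is α[A1]≤3 (from-yes (independentIn? A1 (fromList is))) refl
        (noNeighbourOutside (# 2) (subcubic _) ∷ noNeighbourOutside (# 5) (subcubic _)
         ∷ noNeighbourOutside (# 6) (subcubic _) ∷ []))
  , (λ c deg3≡2 degy≡2 _ → let open CopyRemoval G c; is = # 0 ∷ # 2 ∷ # 4 ∷ # 7 ∷ [] in
      α-drop is α[A2]≤4 (from-yes (independentIn? A2 (fromList is))) refl
        (noNeighbourOutside (# 0) (subcubic _) ∷ noNeighbourOutside (# 2) (≤-reflexive deg3≡2)
         ∷ noNeighbourOutside (# 4) (subcubic _) ∷ noNeighbourOutside (# 7) (≤-reflexive degy≡2) ∷ []))
  , (λ c → let open CopyRemoval G c; is = # 0 ∷ # 2 ∷ # 4 ∷ # 7 ∷ [] in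
      α-drop is α[A3]≤4 (from-yes (independentIn? A3 (fromList is))) refl
        (noNeighbourOutside (# 0) (subcubic _) ∷ noNeighbourOutside (# 2) (subcubic _)
         ∷ noNeighbourOutside (# 4) (subcubic _) ∷ noNeighbourOutside (# 7) (subcubic _) ∷ []))
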